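{- For every access sequence $S\in[n]^m$ and every finite set $X\subset\mathbb Q\setminus[n]$ of auxiliary elements, $\mathrm{OPT}(S)=\mathrm{OPT}_X(S)$.
   Context: Dynamic BST model on a finite key set $K\subset\mathbb Q$: an algorithm maintains a BST with key set $K$ (initial tree of its choice); to serve an access to $x\in K$ it touches a connected subtree containing the root and $x$, and may rearrange the touched nodes into any BST shape; the cost of the access is the number of touched nodes. $\mathrm{OPT}(S)$ is the minimum total cost of an offline algorithm serving $S$ with $K=[n]$; $\mathrm{OPT}_X(S)$ is the minimum total cost of an offline algorithm serving $S$ with $K=[n]\cup X$. -}

module Defs where

open import Data.Nat using (ℕ; zero; suc; _+_; _≤_)
open import Data.Integer using (+_)
open import Data.Rational using (ℚ; _/_; _<_)
open import Data.Fin using (Fin; toℕ)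
open import Data.Vec using (Vec; []; _∷_; take; drop)
open import Data.List using (List; []; _∷_; _++_)
open import Data.List.Membership.Propositional using (_∈_)
open import Data.List.Relation.Unary.Linked using (Linked)
open import Data.Product using (Σ; ∃; _×_; _,_)
open import Data.Sum using (_⊎_)
open import Relation.Binary.PropositionalEquality using (_≡_)
open import Function.Bundles using (_⇔_)

KeySet : Set₁
KeySet = ℚ → Set

-- The rational number i+1 corresponding to i : Fin n, so that [n] = {1,…,n}.
key : ∀ {n} → Fin n → ℚ
key i = (+ suc (toℕ i)) / 1

[_] : ℕ → KeySet
[ n ] q = Σ (Fin n) λ i → q ≡ key i

_∪_ : KeySet → List ℚ → KeySet
(K ∪ X) q = K q ⊎ q ∈ X

data Tree : Set where
  leaf : Tree
  node : Tree → ℚ → Tree → Tree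

inorder : Tree → List ℚ
inorder leaf = []
inorder (node l q r) = inorder l ++ (q ∷ inorder r)

IsBST : KeySet → Tree → Set
IsBST K t = Linked _<_ (inorder t) × (∀ q → (q ∈ inorder t) ⇔ K q)

-- A connected subtree containing the root ("top part" of a tree), with
-- k holes where the untouched subtrees hang off (in symmetric order).
data Top : ℕ → Set where
  hole : Top 1
  node : ∀ {a b} → Top a → ℚ → Top b → Top (a + b)

topKeys : ∀ {k} → Top k → List ℚ
topKeys hole = []
topKeys (node l q r) = topKeys l ++ (q ∷ topKeys r)

size : ∀ {k} → Top k → ℕ
size hole = 0
size (node l q r) = size l + suc (size r)

plug : ∀ {k} → Top k → Vec Tree k → Tree
plug hole (t ∷ []) = t
plug (node {a} l q r) v = node (plug l (take a v)) q (plug r (drop a v))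

-- One access to x in a BST with key set K, turning t into t', at cost c:
-- t is cut into a touched top part T (containing the root and x) and the
-- untouched subtrees; the touched nodes are rearranged into a new top part T',
-- and the result must again be a BST with key set K.
record Step (K : KeySet) (t : Tree) (x : ℚ) (c : ℕ) (t' : Tree) : Set where
  field
    holes   : ℕ
    touched : Top holes
    subs    : Vec Tree holes
    newTop  : Top holes
    split   : t ≡ plug touched subs
    hasX    : x ∈ topKeys touched
    result  : t' ≡ plug newTop subs
    isBST'  : IsBST K t'
    cost    : c ≡ size touched

data Serves (K : KeySet) : Tree → List ℚ → ℕ → Set where
  done : ∀ {t} → Serves K t [] 0
  step : ∀ {t t' x c₁ S c₂} → Step K t x c₁ t' → Serves K t' S c₂ →
         Serves K t (x ∷ S) (c₁ + c₂)

-- Some offline algorithm (initial BST of its choice on K) serves S at total cost c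
Achieves : KeySet → List ℚ → ℕ → Set
Achieves K S c = Σ Tree λ t₀ → IsBST K t₀ × Serves K t₀ S c

IsOPT : KeySet → List ℚ → ℕ → Set
IsOPT K S m = Achieves K S m × (∀ c → Achieves K S c → m ≤ c)

toKeys : ∀ {n m} → Vec (Fin n) m → List ℚ
toKeys [] = []
toKeys (i ∷ is) = key i ∷ toKeys is

module Submission where

-- We compare the sets of achievable costs on a key set K and on K with one
-- extra key x ∉ K, for an access sequence that never accesses x.
--   * Insertion.  Put x into every tree of an execution on K as a leaf.  A step
--     cuts the tree into a touched top part and untouched subtrees; x lands in
--     one untouched subtree, namely the one in the hole where the search for x
--     leaves the top part.  Rearranging the top part keeps the touched keys and
--     hence this hole, so every step stays legal at the same cost.
--   * Deletion.  Delete x from every tree of an execution on K ∪ {x}, replacing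
--     it by its predecessor.  An untouched x disappears inside a subtree; a
--     touched x is traded for its predecessor, the maximum of the subtree left
--     of x, which becomes touched instead.  No step gets more expensive.
-- By induction on X every cost on [n] is achievable on [n] ∪ X and every cost
-- on [n] ∪ X is dominated by one on [n], so the optima coincide.

open import Defs
open import Data.Nat using (ℕ)
open import Data.Rational using (ℚ)
open import Data.Fin using (Fin)
open import Data.Vec using (Vec)
open import Data.List using (List)
open import Data.List.Relation.Unary.All using (All)
open import Relation.Nullary using (¬_)
open import Function.Bundles using (_⇔_)

open import Data.Nat using (zero; suc; _+_; _≤_; z≤n; s≤s)
import Data.Nat.Properties as ℕP
open import Data.Rational as ℚ using () renaming (_<_ to _<ℚ_)
import Data.Rational.Properties as ℚP
open import Data.Fin using (zero; suc; toℕ; _↑ˡ_; _↑ʳ_)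
import Data.Fin.Properties as FinP
open import Data.Vec as Vec using ([]; _∷_; updateAt)
import Data.Vec.Properties as VecP
open import Data.List as List using ([]; _∷_; _++_; map; length)
open import Data.Nat.ListAction using (sum)
import Data.Nat.ListAction.Properties as SumP
import Data.List.Properties as ListP
open import Data.List.Relation.Unary.All as All using ([]; _∷_)
import Data.List.Relation.Unary.All.Properties as AllP
open import Data.List.Relation.Unary.Any using (here; there)
open import Data.List.Relation.Unary.AllPairs using (AllPairs; []; _∷_)
import Data.List.Relation.Unary.AllPairs.Properties as AllPairsP
open import Data.List.Relation.Unary.Linked using (Linked)
import Data.List.Relation.Unary.Linked.Properties as LinkedP
open import Data.List.Membership.Propositional using (_∈_; _∉_)
open import Data.List.Relation.Binary.Permutation.Propositional using (_↭_; ↭-refl; ↭-sym; ↭-trans; prep; swap)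
import Data.List.Relation.Binary.Permutation.Propositional.Properties as PermP
open import Data.List.Membership.Propositional.Properties
  using (∈-++⁺ˡ; ∈-++⁺ʳ; ∈-++⁻; ∈-filter⁺; ∈-filter⁻)
open import Data.Maybe using (Maybe; just; nothing)
open import Data.Product using (Σ; Σ-syntax; _×_; _,_; proj₁; proj₂)
open import Data.Sum using (_⊎_; inj₁; inj₂)
import Data.Sum as Sum
open import Data.Empty using (⊥-elim)
open import Relation.Nullary using (Dec; yes; no; contradiction; ¬?)
open import Data.List.Membership.DecPropositional ℚP._≟_ using (_∈?_)
open import Relation.Binary.PropositionalEquality hiding ([_])
open import Function.Bundles using (mk⇔; Equivalence)
open import Function using (id)
open import Relation.Binary.Definitions using (tri<; tri≈; tri>)
open import Data.Nat.Tactic.RingSolver using (solve-∀)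

Sorted : List ℚ → Set
Sorted = AllPairs _<ℚ_

linked⇒sorted : ∀ {xs} → Linked _<ℚ_ xs → Sorted xs
linked⇒sorted = LinkedP.Linked⇒AllPairs ℚP.<-trans

sorted⇒linked : ∀ {xs} → Sorted xs → Linked _<ℚ_ xs
sorted⇒linked = LinkedP.AllPairs⇒Linked

record AroundPivot (xs : List ℚ) (q : ℚ) (ys : List ℚ) : Set where
  constructor around
  field
    sortedˡ : Sorted xs
    sortedʳ : Sorted ys
    xs<q    : ∀ {y} → y ∈ xs → y <ℚ q
    q<ys    : ∀ {y} → y ∈ ys → q <ℚ y

sorted-++⁻ : ∀ xs {ys} → Sorted (xs ++ ys) →
  Sorted xs × Sorted ys × All (λ x → All (x <ℚ_) ys) xs
sorted-++⁻ [] s = [] , s , []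
sorted-++⁻ (x ∷ xs) (x<xsys ∷ s) with sorted-++⁻ xs s
... | sxs , sys , xs<ys = (AllP.++⁻ˡ xs x<xsys ∷ sxs) , sys , (AllP.++⁻ʳ xs x<xsys ∷ xs<ys)

pivot⁻ : ∀ {xs q ys} → Sorted (xs ++ q ∷ ys) → AroundPivot xs q ys
pivot⁻ {xs} s with sorted-++⁻ xs s
... | sxs , (q<ys ∷ sys) , xs<qys =
  around sxs sys (λ y∈ → All.head (All.lookup xs<qys y∈)) (All.lookup q<ys)

pivot⁺ : ∀ {xs q ys} → AroundPivot xs q ys → Sorted (xs ++ q ∷ ys)
pivot⁺ (around sxs sys below above) = AllPairsP.++⁺ sxs (All.tabulate above ∷ sys)
  (All.tabulate (λ y∈ → below y∈ ∷ All.tabulate (λ z∈ → ℚP.<-trans (below y∈) (above z∈))))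

tail-⊆ : ∀ {x y xs ys} → x ≡ y → All (x <ℚ_) xs →
  (∀ {q} → q ∈ x ∷ xs → q ∈ y ∷ ys) → ∀ {q} → q ∈ xs → q ∈ ys
tail-⊆ x≡y x<xs ⊆ q∈ with ⊆ (there q∈)
... | here q≡y = contradiction (trans q≡y (sym x≡y)) (λ q≡x → ℚP.<-irrefl (sym q≡x) (All.lookup x<xs q∈))
... | there q∈ys = q∈ys

sorted-unique : ∀ {xs ys} → Sorted xs → Sorted ys →
  (∀ {q} → q ∈ xs → q ∈ ys) → (∀ {q} → q ∈ ys → q ∈ xs) → xs ≡ ys
sorted-unique {[]} {[]} _ _ _ _ = refl
sorted-unique {[]} {y ∷ ys} _ _ _ ys⊆ with ys⊆ (here refl)
... | ()
sorted-unique {x ∷ xs} {[]} _ _ xs⊆ _ with xs⊆ (here refl)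
... | ()
sorted-unique {x ∷ xs} {y ∷ ys} (x<xs ∷ sxs) (y<ys ∷ sys) xs⊆ ys⊆ =
  cong₂ _∷_ x≡y (sorted-unique sxs sys (tail-⊆ x≡y x<xs xs⊆) (tail-⊆ (sym x≡y) y<ys ys⊆))
  where
  x≡y : x ≡ y
  x≡y with xs⊆ (here refl) | ys⊆ (here refl)
  ... | here x≡y | _ = x≡y
  ... | there _ | here y≡x = sym y≡x
  ... | there x∈ys | there y∈xs = ⊥-elim (ℚP.<-asym (All.lookup x<xs y∈xs) (All.lookup y<ys x∈ys))

bst-inorder : ∀ {K} t t' → IsBST K t → IsBST K t' → inorder t ≡ inorder t'
bst-inorder t t' (s , keys) (s' , keys') = sorted-unique (linked⇒sorted s) (linked⇒sorted s')
  (λ q∈ → Equivalence.from (keys' _) (Equivalence.to (keys _) q∈))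
  (λ q∈ → Equivalence.from (keys _) (Equivalence.to (keys' _) q∈))

splitAt-++ : ∀ {A : Set} {a b} (vl : Vec A a) (vr : Vec A b) →
  Vec.splitAt a (vl Vec.++ vr) ≡ (vl , vr , refl)
splitAt-++ [] vr = refl
splitAt-++ (x ∷ vl) vr rewrite splitAt-++ vl vr = refl

plug-node : ∀ {a b} (l : Top a) q (r : Top b) (vl : Vec Tree a) (vr : Vec Tree b) →
  plug (node l q r) (vl Vec.++ vr) ≡ node (plug l vl) q (plug r vr)
plug-node {a} l q r vl vr rewrite splitAt-++ vl vr = refl

holes-count : ∀ {k} (T : Top k) → k ≡ suc (length (topKeys T))
holes-count hole = refl
holes-count (node l q r) rewrite ListP.length-++ (topKeys l) {q ∷ topKeys r} =
  cong₂ _+_ (holes-count l) (holes-count r)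

touched⊆ : ∀ {k} (T : Top k) (v : Vec Tree k) {y} → y ∈ topKeys T → y ∈ inorder (plug T v)
touched⊆ hole v ()
touched⊆ (node {a} l q r) v y∈ with Vec.splitAt a v | ∈-++⁻ (topKeys l) y∈
... | vl , vr , refl | inj₁ y∈l = ∈-++⁺ˡ (touched⊆ l vl y∈l)
... | vl , vr , refl | inj₂ (here refl) = ∈-++⁺ʳ _ (here refl)
... | vl , vr , refl | inj₂ (there y∈r) = ∈-++⁺ʳ _ (there (touched⊆ r vr y∈r))

touched-sorted : ∀ {k} (T : Top k) (v : Vec Tree k) →
  Sorted (inorder (plug T v)) → Sorted (topKeys T)
touched-sorted hole v s = []
touched-sorted (node {a} l q r) v s with Vec.splitAt a v
... | vl , vr , refl with pivot⁻ {inorder (plug l vl)} s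
... | around sl sr below above = pivot⁺ (around (touched-sorted l vl sl) (touched-sorted r vr sr)
        (λ y∈ → below (touched⊆ l vl y∈)) (λ y∈ → above (touched⊆ r vr y∈)))

-- Rearranging the touched part changes neither the touched keys nor the
-- hole into which a given key falls.  Both facts are read off from
-- weighted key counts, which are additive over touched part and subtrees.
weight : (ℚ → ℕ) → List ℚ → ℕ
weight f ks = sum (map f ks)

weight-++ : ∀ f xs ys → weight f (xs ++ ys) ≡ weight f xs + weight f ys
weight-++ f xs ys = trans (cong sum (ListP.map-++ f xs ys)) (SumP.sum-++ (map f xs) (map f ys))

subtreeWeight : ∀ {k} → (ℚ → ℕ) → Vec Tree k → ℕ
subtreeWeight f v = Vec.sum (Vec.map (λ t → weight f (inorder t)) v)

subtreeWeight-++ : ∀ {a b} f (vl : Vec Tree a) (vr : Vec Tree b) →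
  subtreeWeight f (vl Vec.++ vr) ≡ subtreeWeight f vl + subtreeWeight f vr
subtreeWeight-++ f vl vr = trans (cong Vec.sum (VecP.map-++ (λ t → weight f (inorder t)) vl vr))
  (VecP.sum-++ (Vec.map (λ t → weight f (inorder t)) vl))

regroup : ∀ a b c d e → (a + b) + (c + (d + e)) ≡ (a + (c + d)) + (b + e)
regroup = solve-∀

weight-plug : ∀ {k} f (T : Top k) (v : Vec Tree k) →
  weight f (inorder (plug T v)) ≡ weight f (topKeys T) + subtreeWeight f v
weight-plug f hole (t ∷ []) = sym (ℕP.+-identityʳ _)
weight-plug f (node {a} l q r) v with Vec.splitAt a v
... | vl , vr , refl = begin
  weight f (inorder (plug l vl) ++ q ∷ inorder (plug r vr))
    ≡⟨ weight-++ f (inorder (plug l vl)) _ ⟩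
  weight f (inorder (plug l vl)) + (f q + weight f (inorder (plug r vr)))
    ≡⟨ cong₂ (λ x y → x + (f q + y)) (weight-plug f l vl) (weight-plug f r vr) ⟩
  (weight f (topKeys l) + subtreeWeight f vl) + (f q + (weight f (topKeys r) + subtreeWeight f vr))
    ≡⟨ regroup (weight f (topKeys l)) _ (f q) _ _ ⟩
  (weight f (topKeys l) + (f q + weight f (topKeys r))) + (subtreeWeight f vl + subtreeWeight f vr)
    ≡⟨ sym (cong₂ _+_ (weight-++ f (topKeys l) _) (subtreeWeight-++ f vl vr)) ⟩
  weight f (topKeys (node l q r)) + subtreeWeight f (vl Vec.++ vr) ∎
  where open ≡-Reasoning

weight-ones : ∀ f ks → (∀ {y} → y ∈ ks → f y ≡ 1) → weight f ks ≡ length ks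
weight-ones f [] _ = refl
weight-ones f (k ∷ ks) ones = cong₂ _+_ (ones (here refl)) (weight-ones f ks (λ y∈ → ones (there y∈)))

weight-zeros : ∀ f ks → (∀ {y} → y ∈ ks → f y ≡ 0) → weight f ks ≡ 0
weight-zeros f [] _ = refl
weight-zeros f (k ∷ ks) zeros = cong₂ _+_ (zeros (here refl)) (weight-zeros f ks (λ y∈ → zeros (there y∈)))

indicator : ∀ {P : Set} → Dec P → ℕ
indicator (yes _) = 1
indicator (no _) = 0

indicator-yes : ∀ {P : Set} (d : Dec P) → P → indicator d ≡ 1
indicator-yes (yes _) _ = refl
indicator-yes (no ¬p) p = contradiction p ¬p

indicator-no : ∀ {P : Set} (d : Dec P) → ¬ P → indicator d ≡ 0
indicator-no (yes p) ¬p = contradiction p ¬p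
indicator-no (no _) _ = refl

touched-weight : ∀ {K k} f (T T' : Top k) (v : Vec Tree k) →
  IsBST K (plug T v) → IsBST K (plug T' v) → weight f (topKeys T) ≡ weight f (topKeys T')
touched-weight f T T' v bst bst' = ℕP.+-cancelʳ-≡ (subtreeWeight f v) _ _ (begin
  weight f (topKeys T) + subtreeWeight f v    ≡⟨ sym (weight-plug f T v) ⟩
  weight f (inorder (plug T v))               ≡⟨ cong (weight f) (bst-inorder (plug T v) (plug T' v) bst bst') ⟩
  weight f (inorder (plug T' v))              ≡⟨ weight-plug f T' v ⟩
  weight f (topKeys T') + subtreeWeight f v   ∎)
  where open ≡-Reasoning

occurrences : ℚ → List ℚ → ℕ
occurrences y = weight (λ q → indicator (q ℚP.≟ y))

∈⇒occurs : ∀ {y ks} → y ∈ ks → 1 ≤ occurrences y ks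
∈⇒occurs {y} (here refl) with y ℚP.≟ y
... | yes _ = s≤s z≤n
... | no y≢y = contradiction refl y≢y
∈⇒occurs {y} {k ∷ ks} (there y∈) = ℕP.≤-trans (∈⇒occurs y∈) (ℕP.m≤n+m _ (indicator (k ℚP.≟ y)))

occurs⇒∈ : ∀ {y ks} → 1 ≤ occurrences y ks → y ∈ ks
occurs⇒∈ {y} {k ∷ ks} occ with k ℚP.≟ y
... | yes refl = here refl
... | no _ = there (occurs⇒∈ occ)

touched-invariant : ∀ {K k} (T T' : Top k) (v : Vec Tree k) →
  IsBST K (plug T v) → IsBST K (plug T' v) → topKeys T ≡ topKeys T'
touched-invariant T T' v bst bst' = sorted-unique
  (touched-sorted T v (linked⇒sorted (proj₁ bst))) (touched-sorted T' v (linked⇒sorted (proj₁ bst')))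
  (transfer T T' bst bst') (transfer T' T bst' bst)
  where
  transfer : ∀ {K} (T₁ T₂ : Top _) → IsBST K (plug T₁ v) → IsBST K (plug T₂ v) →
    ∀ {y} → y ∈ topKeys T₁ → y ∈ topKeys T₂
  transfer T₁ T₂ b₁ b₂ {y} y∈ =
    occurs⇒∈ (subst (1 ≤_) (touched-weight _ T₁ T₂ v b₁ b₂) (∈⇒occurs y∈))

hole-of : ∀ {k} → ℚ → Top k → Fin k
hole-of x hole = zero
hole-of x (node {a} {b} l q r) with q ℚ.<? x
... | yes _ = a ↑ʳ hole-of x r
... | no _ = hole-of x l ↑ˡ b

below : ℚ → ℚ → ℕ
below x q = indicator (q ℚ.<? x)

hole-of-rank : ∀ {k} x (T : Top k) → Sorted (topKeys T) → toℕ (hole-of x T) ≡ weight (below x) (topKeys T)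
hole-of-rank x hole _ = refl
hole-of-rank x (node {a} {b} l q r) s with pivot⁻ {topKeys l} s | q ℚ.<? x
... | around sl sr lt gt | yes q<x = begin
  toℕ (a ↑ʳ hole-of x r)                             ≡⟨ FinP.toℕ-↑ʳ a _ ⟩
  a + toℕ (hole-of x r)                              ≡⟨ cong₂ _+_ (holes-count l) (hole-of-rank x r sr) ⟩
  suc (length (topKeys l)) + weight (below x) (topKeys r)
                                                     ≡⟨ sym (ℕP.+-suc _ _) ⟩
  length (topKeys l) + (1 + weight (below x) (topKeys r))
    ≡⟨ sym (cong₂ (λ m c → m + (c + weight (below x) (topKeys r))) l-below q-below) ⟩
  weight (below x) (topKeys l) + (below x q + weight (below x) (topKeys r))
                                                     ≡⟨ sym (weight-++ (below x) (topKeys l) _) ⟩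
  weight (below x) (topKeys l ++ q ∷ topKeys r)      ∎
  where
  open ≡-Reasoning
  l-below : weight (below x) (topKeys l) ≡ length (topKeys l)
  l-below = weight-ones (below x) (topKeys l) (λ y∈ → indicator-yes (_ ℚ.<? x) (ℚP.<-trans (lt y∈) q<x))
  q-below : below x q ≡ 1
  q-below = indicator-yes (q ℚ.<? x) q<x
... | around sl sr lt gt | no q≮x = begin
  toℕ (hole-of x l ↑ˡ b)                             ≡⟨ FinP.toℕ-↑ˡ _ b ⟩
  toℕ (hole-of x l)                                  ≡⟨ hole-of-rank x l sl ⟩
  weight (below x) (topKeys l)                       ≡⟨ sym (ℕP.+-identityʳ _) ⟩
  weight (below x) (topKeys l) + (0 + 0)
    ≡⟨ sym (cong₂ (λ c d → weight (below x) (topKeys l) + (c + d)) q-above r-above) ⟩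
  weight (below x) (topKeys l) + (below x q + weight (below x) (topKeys r))
                                                     ≡⟨ sym (weight-++ (below x) (topKeys l) _) ⟩
  weight (below x) (topKeys l ++ q ∷ topKeys r)      ∎
  where
  open ≡-Reasoning
  q-above : below x q ≡ 0
  q-above = indicator-no (q ℚ.<? x) q≮x
  r-above : weight (below x) (topKeys r) ≡ 0
  r-above = weight-zeros (below x) (topKeys r)
    (λ y∈ → indicator-no (_ ℚ.<? x) (λ y<x → q≮x (ℚP.<-trans (gt y∈) y<x)))

hole-of-invariant : ∀ {K k} x (T T' : Top k) (v : Vec Tree k) →
  IsBST K (plug T v) → IsBST K (plug T' v) → hole-of x T ≡ hole-of x T'
hole-of-invariant x T T' v bst bst' = FinP.toℕ-injective (begin
  toℕ (hole-of x T)                 ≡⟨ hole-of-rank x T (touched-sorted T v (linked⇒sorted (proj₁ bst))) ⟩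
  weight (below x) (topKeys T)      ≡⟨ cong (weight (below x)) (touched-invariant T T' v bst bst') ⟩
  weight (below x) (topKeys T')
    ≡⟨ sym (hole-of-rank x T' (touched-sorted T' v (linked⇒sorted (proj₁ bst')))) ⟩
  toℕ (hole-of x T')                ∎)
  where open ≡-Reasoning

step-plugs : ∀ {K t y c t'} → IsBST K t → (st : Step K t y c t') →
  IsBST K (plug (Step.touched st) (Step.subs st)) × IsBST K (plug (Step.newTop st) (Step.subs st))
step-plugs {K} bst st = subst (IsBST K) split bst , subst (IsBST K) result isBST'
  where open Step st

step-touched : ∀ {K t y c t'} → IsBST K t → (st : Step K t y c t') →
  topKeys (Step.touched st) ≡ topKeys (Step.newTop st)
step-touched bst st with step-plugs bst st
... | before , after = touched-invariant (Step.touched st) (Step.newTop st) (Step.subs st) before after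

step-hole-of : ∀ {K t y c t'} x → IsBST K t → (st : Step K t y c t') →
  hole-of x (Step.touched st) ≡ hole-of x (Step.newTop st)
step-hole-of x bst st with step-plugs bst st
... | before , after = hole-of-invariant x (Step.touched st) (Step.newTop st) (Step.subs st) before after

_⊕_ : KeySet → ℚ → KeySet
(K ⊕ x) q = K q ⊎ q ≡ x

_≐_ : KeySet → KeySet → Set
K ≐ K' = ∀ q → K q ⇔ K' q

≐-sym : ∀ {K K'} → K ≐ K' → K' ≐ K
≐-sym K≐K' q = mk⇔ (Equivalence.from (K≐K' q)) (Equivalence.to (K≐K' q))

bst-resp : ∀ {K K'} → K ≐ K' → ∀ t → IsBST K t → IsBST K' t
bst-resp K≐K' t (s , keys) = s , λ q → mk⇔
  (λ q∈ → Equivalence.to (K≐K' q) (Equivalence.to (keys q) q∈))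
  (λ q∈K' → Equivalence.from (keys q) (Equivalence.from (K≐K' q) q∈K'))

step-resp : ∀ {K K'} → K ≐ K' → ∀ {t x c t'} → Step K t x c t' → Step K' t x c t'
step-resp K≐K' {t' = t'} st = record
  { holes = holes ; touched = touched ; subs = subs ; newTop = newTop ; split = split
  ; hasX = hasX ; result = result ; isBST' = bst-resp K≐K' t' isBST' ; cost = cost }
  where open Step st

serves-resp : ∀ {K K'} → K ≐ K' → ∀ {t S c} → Serves K t S c → Serves K' t S c
serves-resp K≐K' done = done
serves-resp K≐K' (step st rest) = step (step-resp K≐K' st) (serves-resp K≐K' rest)

achieves-resp : ∀ {K K'} → K ≐ K' → ∀ {S c} → Achieves K S c → Achieves K' S c
achieves-resp K≐K' (t₀ , bst , serves) = t₀ , bst-resp K≐K' t₀ bst , serves-resp K≐K' serves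

ins : ℚ → Tree → Tree
ins x leaf = node leaf x leaf
ins x (node l q r) with q ℚ.<? x
... | yes _ = node l q (ins x r)
... | no _ = node (ins x l) q r

ins-↭ : ∀ x t → inorder (ins x t) ↭ x ∷ inorder t
ins-↭ x leaf = ↭-refl
ins-↭ x (node l q r) with q ℚ.<? x
... | yes _ = ↭-trans (PermP.++⁺ˡ (inorder l) (prep q (ins-↭ x r)))
             (↭-trans (PermP.++⁺ˡ (inorder l) (swap q x ↭-refl)) (PermP.shift x (inorder l) _))
... | no _ = PermP.++⁺ʳ (q ∷ inorder r) (ins-↭ x l)

ins-∈⁻ : ∀ {x y} t → y ∈ inorder (ins x t) → y ≡ x ⊎ y ∈ inorder t
ins-∈⁻ {x} t y∈ with PermP.∈-resp-↭ (ins-↭ x t) y∈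
... | here y≡x = inj₁ y≡x
... | there y∈t = inj₂ y∈t

ins-∈⁺ : ∀ {x y} t → y ≡ x ⊎ y ∈ inorder t → y ∈ inorder (ins x t)
ins-∈⁺ {x} t (inj₁ y≡x) = PermP.∈-resp-↭ (↭-sym (ins-↭ x t)) (here y≡x)
ins-∈⁺ {x} t (inj₂ y∈t) = PermP.∈-resp-↭ (↭-sym (ins-↭ x t)) (there y∈t)

ins-sorted : ∀ {x} t → Sorted (inorder t) → x ∉ inorder t → Sorted (inorder (ins x t))
ins-sorted leaf s x∉ = [] ∷ []
ins-sorted {x} (node l q r) s x∉ with pivot⁻ {inorder l} s | q ℚ.<? x
... | around sl sr lt gt | yes q<x =
  pivot⁺ (around sl (ins-sorted r sr (λ x∈ → x∉ (∈-++⁺ʳ _ (there x∈)))) lt gt')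
  where
  gt' : ∀ {y} → y ∈ inorder (ins x r) → q <ℚ y
  gt' y∈ with ins-∈⁻ r y∈
  ... | inj₁ refl = q<x
  ... | inj₂ y∈r = gt y∈r
... | around sl sr lt gt | no q≮x =
  pivot⁺ (around (ins-sorted l sl (λ x∈ → x∉ (∈-++⁺ˡ x∈))) sr lt' gt)
  where
  x<q : x <ℚ q
  x<q with ℚP.<-cmp x q
  ... | tri< x<q _ _ = x<q
  ... | tri≈ _ refl _ = ⊥-elim (x∉ (∈-++⁺ʳ _ (here refl)))
  ... | tri> _ _ q<x = ⊥-elim (q≮x q<x)
  lt' : ∀ {y} → y ∈ inorder (ins x l) → y <ℚ q
  lt' y∈ with ins-∈⁻ l y∈
  ... | inj₁ refl = x<q
  ... | inj₂ y∈l = lt y∈l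

ins-bst : ∀ {K x} t → IsBST K t → ¬ K x → IsBST (K ⊕ x) (ins x t)
ins-bst {K} {x} t (s , keys) x∉K =
  sorted⇒linked (ins-sorted t (linked⇒sorted s) (λ x∈ → x∉K (Equivalence.to (keys x) x∈))) ,
  λ q → mk⇔ (λ q∈ → Sum.map (Equivalence.to (keys q)) id (Sum.swap (ins-∈⁻ t q∈)))
            (λ q∈ → ins-∈⁺ t (Sum.swap (Sum.map (Equivalence.from (keys q)) id q∈)))

module _ {A : Set} where
  updateAt-↑ˡ : ∀ {a b} (vl : Vec A a) (vr : Vec A b) i f →
    updateAt (vl Vec.++ vr) (i ↑ˡ b) f ≡ updateAt vl i f Vec.++ vr
  updateAt-↑ˡ (x ∷ vl) vr zero f = refl
  updateAt-↑ˡ (x ∷ vl) vr (suc i) f = cong (x ∷_) (updateAt-↑ˡ vl vr i f)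

  updateAt-↑ʳ : ∀ {a b} (vl : Vec A a) (vr : Vec A b) i f →
    updateAt (vl Vec.++ vr) (a ↑ʳ i) f ≡ vl Vec.++ updateAt vr i f
  updateAt-↑ʳ [] vr i f = refl
  updateAt-↑ʳ (x ∷ vl) vr i f = cong (x ∷_) (updateAt-↑ʳ vl vr i f)

ins-plug : ∀ {k} x (T : Top k) (v : Vec Tree k) →
  ins x (plug T v) ≡ plug T (updateAt v (hole-of x T) (ins x))
ins-plug x hole (t ∷ []) = refl
ins-plug x (node {a} {b} l q r) v with Vec.splitAt a v
... | vl , vr , refl with q ℚ.<? x
... | yes _ = begin
  node (plug l vl) q (ins x (plug r vr))
    ≡⟨ cong (node (plug l vl) q) (ins-plug x r vr) ⟩
  node (plug l vl) q (plug r (updateAt vr (hole-of x r) (ins x)))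
    ≡⟨ sym (plug-node l q r vl _) ⟩
  plug (node l q r) (vl Vec.++ updateAt vr (hole-of x r) (ins x))
    ≡⟨ cong (plug (node l q r)) (sym (updateAt-↑ʳ vl vr (hole-of x r) (ins x))) ⟩
  plug (node l q r) (updateAt (vl Vec.++ vr) (a ↑ʳ hole-of x r) (ins x)) ∎
  where open ≡-Reasoning
... | no _ = begin
  node (ins x (plug l vl)) q (plug r vr)
    ≡⟨ cong (λ t → node t q (plug r vr)) (ins-plug x l vl) ⟩
  node (plug l (updateAt vl (hole-of x l) (ins x))) q (plug r vr)
    ≡⟨ sym (plug-node l q r _ vr) ⟩
  plug (node l q r) (updateAt vl (hole-of x l) (ins x) Vec.++ vr)
    ≡⟨ cong (plug (node l q r)) (sym (updateAt-↑ˡ vl vr (hole-of x l) (ins x))) ⟩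
  plug (node l q r) (updateAt (vl Vec.++ vr) (hole-of x l ↑ˡ b) (ins x)) ∎
  where open ≡-Reasoning

ins-step : ∀ {K x t y c t'} → ¬ K x → IsBST K t → Step K t y c t' → Step (K ⊕ x) (ins x t) y c (ins x t')
ins-step {x = x} {t' = t'} x∉K bst st = record
  { holes = holes ; touched = touched ; subs = updateAt subs (hole-of x touched) (ins x) ; newTop = newTop
  ; split = trans (cong (ins x) split) (ins-plug x touched subs)
  ; hasX = hasX
  ; result = begin
      ins x t'                                                ≡⟨ cong (ins x) result ⟩
      ins x (plug newTop subs)                                ≡⟨ ins-plug x newTop subs ⟩
      plug newTop (updateAt subs (hole-of x newTop) (ins x))
        ≡⟨ cong (λ i → plug newTop (updateAt subs i (ins x))) (sym (step-hole-of x bst st)) ⟩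
      plug newTop (updateAt subs (hole-of x touched) (ins x)) ∎
  ; isBST' = ins-bst t' isBST' x∉K
  ; cost = cost }
  where
  open Step st
  open ≡-Reasoning

ins-serves : ∀ {K x t S c} → ¬ K x → IsBST K t → Serves K t S c → Serves (K ⊕ x) (ins x t) S c
ins-serves x∉K bst done = done
ins-serves x∉K bst (step st rest) = step (ins-step x∉K bst st) (ins-serves x∉K (Step.isBST' st) rest)

achieves-ins : ∀ {K x S c} → ¬ K x → Achieves K S c → Achieves (K ⊕ x) S c
achieves-ins {x = x} x∉K (t₀ , bst , serves) = ins x t₀ , ins-bst t₀ bst x∉K , ins-serves x∉K bst serves

attach : Tree → ℚ → Maybe (Tree × ℚ) → Tree × ℚ
attach l q nothing = l , q
attach l q (just (r' , m)) = node l q r' , m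

unsnoc : Tree → Maybe (Tree × ℚ)
unsnoc leaf = nothing
unsnoc (node l q r) = just (attach l q (unsnoc r))

joinWith : Maybe (Tree × ℚ) → Tree → Tree
joinWith nothing r = r
joinWith (just (l' , m)) r = node l' m r

-- Deletion of x (searching both sides, so that it is defined on all trees).
del : ℚ → Tree → Tree
del x leaf = leaf
del x (node l q r) with q ℚP.≟ x
... | yes _ = joinWith (unsnoc l) r
... | no _ = node (del x l) q (del x r)

inorder-unsnoc : Maybe (Tree × ℚ) → List ℚ
inorder-unsnoc nothing = []
inorder-unsnoc (just (t , m)) = inorder t ++ m ∷ []

unsnoc-inorder : ∀ t → inorder-unsnoc (unsnoc t) ≡ inorder t
unsnoc-inorder leaf = refl
unsnoc-inorder (node l q r) with unsnoc r | unsnoc-inorder r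
... | nothing | eq = cong (λ z → inorder l ++ q ∷ z) eq
... | just (r' , m) | eq = trans (ListP.++-assoc (inorder l) (q ∷ inorder r') (m ∷ []))
                                 (cong (λ z → inorder l ++ q ∷ z) eq)

joinWith-inorder : ∀ l r → inorder (joinWith (unsnoc l) r) ≡ inorder l ++ inorder r
joinWith-inorder l r with unsnoc l | unsnoc-inorder l
... | nothing | eq = cong (_++ inorder r) eq
... | just (l' , m) | eq = trans (sym (ListP.++-assoc (inorder l') (m ∷ []) (inorder r)))
                                 (cong (_++ inorder r) eq)

differs? : ∀ x q → Dec (q ≢ x)
differs? x q = ¬? (q ℚP.≟ x)

without : ℚ → List ℚ → List ℚ
without x = List.filter (differs? x)

without-∉ : ∀ {x xs} → x ∉ xs → without x xs ≡ xs
without-∉ {x} {xs} x∉ =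
  ListP.filter-all (differs? x) (All.tabulate (λ y∈ y≡x → x∉ (subst (_∈ xs) y≡x y∈)))

del-inorder : ∀ x t → Sorted (inorder t) → inorder (del x t) ≡ without x (inorder t)
del-inorder x leaf s = refl
del-inorder x (node l q r) s with pivot⁻ {inorder l} s | q ℚP.≟ x
... | around sl sr lt gt | yes refl = begin
  inorder (joinWith (unsnoc l) r)                    ≡⟨ joinWith-inorder l r ⟩
  inorder l ++ inorder r
    ≡⟨ sym (cong₂ _++_ (without-∉ (λ x∈ → ℚP.<-irrefl refl (lt x∈)))
                       (without-∉ (λ x∈ → ℚP.<-irrefl refl (gt x∈)))) ⟩
  without x (inorder l) ++ without x (inorder r)
    ≡⟨ cong (without x (inorder l) ++_) (sym (ListP.filter-reject (differs? x) (λ x≢x → x≢x refl))) ⟩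
  without x (inorder l) ++ without x (x ∷ inorder r) ≡⟨ sym (ListP.filter-++ (differs? x) (inorder l) _) ⟩
  without x (inorder l ++ x ∷ inorder r)             ∎
  where open ≡-Reasoning
... | around sl sr lt gt | no q≢x = begin
  inorder (del x l) ++ q ∷ inorder (del x r)
    ≡⟨ cong₂ (λ ls rs → ls ++ q ∷ rs) (del-inorder x l sl) (del-inorder x r sr) ⟩
  without x (inorder l) ++ q ∷ without x (inorder r)
    ≡⟨ cong (without x (inorder l) ++_) (sym (ListP.filter-accept (differs? x) q≢x)) ⟩
  without x (inorder l) ++ without x (q ∷ inorder r)
    ≡⟨ sym (ListP.filter-++ (differs? x) (inorder l) _) ⟩
  without x (inorder l ++ q ∷ inorder r) ∎
  where open ≡-Reasoning

del-bst : ∀ {K x} t → IsBST (K ⊕ x) t → ¬ K x → IsBST K (del x t)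
del-bst {K} {x} t (s , keys) x∉K rewrite del-inorder x t (linked⇒sorted s) =
  sorted⇒linked (AllPairsP.filter⁺ (differs? x) (linked⇒sorted s)) ,
  λ q → mk⇔ (λ q∈ → kept (∈-filter⁻ (differs? x) q∈))
            (λ q∈K → ∈-filter⁺ (differs? x) (Equivalence.from (keys q) (inj₁ q∈K))
                       (λ q≡x → x∉K (subst K q≡x q∈K)))
  where
  kept : ∀ {q} → q ∈ inorder t × q ≢ x → K q
  kept (q∈ , q≢x) with Equivalence.to (keys _) q∈
  ... | inj₁ q∈K = q∈K
  ... | inj₂ q≡x = ⊥-elim (q≢x q≡x)

del-∉ : ∀ {x} t → x ∉ inorder t → del x t ≡ t
del-∉ leaf x∉ = refl
del-∉ {x} (node l q r) x∉ with q ℚP.≟ x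
... | yes refl = ⊥-elim (x∉ (∈-++⁺ʳ (inorder l) (here refl)))
... | no _ = cong₂ (λ l' r' → node l' q r') (del-∉ l (λ x∈ → x∉ (∈-++⁺ˡ x∈)))
                                              (del-∉ r (λ x∈ → x∉ (∈-++⁺ʳ _ (there x∈))))

del-plug-untouched : ∀ {k} x (T : Top k) (v : Vec Tree k) → x ∉ topKeys T →
  del x (plug T v) ≡ plug T (Vec.map (del x) v)
del-plug-untouched x hole (t ∷ []) x∉ = refl
del-plug-untouched x (node {a} l q r) v x∉ with Vec.splitAt a v
... | vl , vr , refl rewrite VecP.map-++ (del x) vl vr | splitAt-++ (Vec.map (del x) vl) (Vec.map (del x) vr)
  with q ℚP.≟ x
... | yes refl = ⊥-elim (x∉ (∈-++⁺ʳ (topKeys l) (here refl)))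
... | no _ = cong₂ (λ l' r' → node l' q r') (del-plug-untouched x l vl (λ x∈ → x∉ (∈-++⁺ˡ x∈)))
                                              (del-plug-untouched x r vr (λ x∈ → x∉ (∈-++⁺ʳ _ (there x∈))))

Subtrees : Set
Subtrees = Σ ℕ (Vec Tree)

-- Remove the maximum of the subtree in hole j; an empty subtree loses its hole.
dropMaxAt : ∀ {k} → Vec Tree k → Fin k → Subtrees
dropMaxAt (t ∷ v) zero with unsnoc t
... | nothing = _ , v
... | just (t' , _) = _ , t' ∷ v
dropMaxAt (t ∷ v) (suc j) = suc (proj₁ (dropMaxAt v j)) , t ∷ proj₂ (dropMaxAt v j)

dropMaxAt-↑ˡ : ∀ {a b} (vl : Vec Tree a) (vr : Vec Tree b) i →
  dropMaxAt (vl Vec.++ vr) (i ↑ˡ b) ≡ (proj₁ (dropMaxAt vl i) + b , proj₂ (dropMaxAt vl i) Vec.++ vr)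
dropMaxAt-↑ˡ (t ∷ vl) vr zero with unsnoc t
... | nothing = refl
... | just _ = refl
dropMaxAt-↑ˡ (t ∷ vl) vr (suc i) rewrite dropMaxAt-↑ˡ vl vr i = refl

dropMaxAt-↑ʳ : ∀ {a b} (vl : Vec Tree a) (vr : Vec Tree b) i →
  dropMaxAt (vl Vec.++ vr) (a ↑ʳ i) ≡ (a + proj₁ (dropMaxAt vr i) , vl Vec.++ proj₂ (dropMaxAt vr i))
dropMaxAt-↑ʳ [] vr i = refl
dropMaxAt-↑ʳ (t ∷ vl) vr i rewrite dropMaxAt-↑ʳ vl vr i = refl

-- How the maximum split of a plugged tree looks when the maximum lies in
-- the last hole: either everything is empty, or the maximum p comes out of
-- that subtree and the remaining tree is plugged from a top part L that
-- is no larger than the original one and misses none of its keys but p.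
data MaxSplit (s : ℕ) (ks : List ℚ) (ts : Subtrees) : Maybe (Tree × ℚ) → Set where
  empty  : ks ≡ [] → ts ≡ (0 , []) → MaxSplit s ks ts nothing
  popped : ∀ {t} (L : Top (proj₁ ts)) p → t ≡ plug L (proj₂ ts) → size L ≤ s →
           (∀ {y} → y ∈ ks → y ≡ p ⊎ y ∈ topKeys L) → MaxSplit s ks ts (just (t , p))

++-[]-Subtrees : ∀ {a} (v : Vec Tree a) → _≡_ {A = Subtrees} (a + 0 , v Vec.++ []) (a , v)
++-[]-Subtrees [] = refl
++-[]-Subtrees (t ∷ v) = cong (λ ts → suc (proj₁ ts) , t ∷ proj₂ ts) (++-[]-Subtrees v)

-- If all touched keys lie below x, the maximum of the plugged tree lies in
-- the hole of x, which is the last one.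
unsnoc-plug : ∀ {a} x (L : Top a) (v : Vec Tree a) → (∀ {y} → y ∈ topKeys L → y <ℚ x) →
  MaxSplit (size L) (topKeys L) (dropMaxAt v (hole-of x L)) (unsnoc (plug L v))
unsnoc-plug x hole (t ∷ []) _ with unsnoc t
... | nothing = empty refl refl
... | just (t' , p) = popped hole p refl z≤n (λ ())
unsnoc-plug x (node {a} l q r) v L<x with Vec.splitAt a v
... | vl , vr , refl with q ℚ.<? x
... | no q≮x = ⊥-elim (q≮x (L<x (∈-++⁺ʳ (topKeys l) (here refl))))
... | yes _ rewrite dropMaxAt-↑ʳ vl vr (hole-of x r)
  with unsnoc (plug r vr) | unsnoc-plug x r vr (λ y∈ → L<x (∈-++⁺ʳ (topKeys l) (there y∈)))
... | nothing | empty r≡[] ts≡ rewrite ts≡ | r≡[] =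
  subst (λ ts → MaxSplit (size l + suc (size r)) (topKeys l ++ q ∷ []) ts (just (plug l vl , q)))
        (sym (++-[]-Subtrees vl)) (popped l q refl (ℕP.m≤m+n _ _) onlyQ)
  where
  onlyQ : ∀ {y} → y ∈ topKeys l ++ q ∷ [] → y ≡ q ⊎ y ∈ topKeys l
  onlyQ y∈ with ∈-++⁻ (topKeys l) y∈
  ... | inj₁ y∈l = inj₂ y∈l
  ... | inj₂ (here y≡q) = inj₁ y≡q
... | just _ | popped L p t≡ L≤r keys =
  popped (node l q L) p (trans (cong (node (plug l vl) q) t≡) (sym (plug-node l q L vl _)))
         (ℕP.+-monoʳ-≤ (size l) (s≤s L≤r)) keys'
  where
  keys' : ∀ {y} → y ∈ topKeys l ++ q ∷ topKeys r → y ≡ p ⊎ y ∈ topKeys l ++ q ∷ topKeys L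
  keys' y∈ with ∈-++⁻ (topKeys l) y∈
  ... | inj₁ y∈l = inj₂ (∈-++⁺ˡ y∈l)
  ... | inj₂ (here y≡q) = inj₂ (∈-++⁺ʳ _ (here y≡q))
  ... | inj₂ (there y∈r) = Sum.map id (λ y∈L → ∈-++⁺ʳ _ (there y∈L)) (keys y∈r)

record Replugged (x : ℚ) (s : ℕ) (ks : List ℚ) (ts : Subtrees) (t : Tree) : Set where
  field
    top     : Top (proj₁ ts)
    plugged : t ≡ plug top (proj₂ ts)
    smaller : size top ≤ s
    keeps   : ∀ {y} → y ∈ ks → y ≢ x → y ∈ topKeys top

replug-root : ∀ {a b} x (l : Top a) (r : Top b) (vl : Vec Tree a) (vr : Vec Tree b) →
  (∀ {y} → y ∈ topKeys l → y <ℚ x) →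
  Replugged x (size (node l x r)) (topKeys (node l x r)) (dropMaxAt (vl Vec.++ vr) (hole-of x l ↑ˡ b))
            (joinWith (unsnoc (plug l vl)) (plug r vr))
replug-root x l r vl vr l<x rewrite dropMaxAt-↑ˡ vl vr (hole-of x l)
  with unsnoc (plug l vl) | unsnoc-plug x l vl l<x
... | nothing | empty l≡[] ts≡ rewrite ts≡ = record
  { top = r ; plugged = refl ; smaller = ℕP.≤-trans (ℕP.n≤1+n _) (ℕP.m≤n+m _ (size l)) ; keeps = keeps }
  where
  keeps : ∀ {y} → y ∈ topKeys l ++ x ∷ topKeys r → y ≢ x → y ∈ topKeys r
  keeps y∈ y≢x with ∈-++⁻ (topKeys l) y∈
  ... | inj₂ (here y≡x) = ⊥-elim (y≢x y≡x)
  ... | inj₂ (there y∈r) = y∈r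
  ... | inj₁ y∈l with subst (_ ∈_) l≡[] y∈l
  ...   | ()
... | just _ | popped L p t≡ L≤l keysL = record
  { top = node L p r
  ; plugged = trans (cong (λ t → node t p (plug r vr)) t≡) (sym (plug-node L p r _ vr))
  ; smaller = ℕP.+-monoˡ-≤ (suc (size r)) L≤l
  ; keeps = keeps }
  where
  keeps : ∀ {y} → y ∈ topKeys l ++ x ∷ topKeys r → y ≢ x → y ∈ topKeys L ++ p ∷ topKeys r
  keeps y∈ y≢x with ∈-++⁻ (topKeys l) y∈
  ... | inj₂ (here y≡x) = ⊥-elim (y≢x y≡x)
  ... | inj₂ (there y∈r) = ∈-++⁺ʳ _ (there y∈r)
  ... | inj₁ y∈l with keysL y∈l
  ...   | inj₁ y≡p = ∈-++⁺ʳ _ (here y≡p)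
  ...   | inj₂ y∈L = ∈-++⁺ˡ y∈L

replug-right : ∀ {a b} x (l : Top a) q (r : Top b) (vl : Vec Tree a) (vr : Vec Tree b) →
  x ∉ inorder (plug l vl) →
  Replugged x (size r) (topKeys r) (dropMaxAt vr (hole-of x r)) (del x (plug r vr)) →
  Replugged x (size (node l q r)) (topKeys (node l q r)) (dropMaxAt (vl Vec.++ vr) (a ↑ʳ hole-of x r))
            (node (del x (plug l vl)) q (del x (plug r vr)))
replug-right x l q r vl vr x∉l R rewrite dropMaxAt-↑ʳ vl vr (hole-of x r) = record
  { top = node l q top
  ; plugged = trans (cong₂ (λ l' r' → node l' q r') (del-∉ (plug l vl) x∉l) plugged) (sym (plug-node l q top vl _))
  ; smaller = ℕP.+-monoʳ-≤ (size l) (s≤s smaller)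
  ; keeps = keeps' }
  where
  open Replugged R
  keeps' : ∀ {y} → y ∈ topKeys l ++ q ∷ topKeys r → y ≢ x → y ∈ topKeys l ++ q ∷ topKeys top
  keeps' y∈ y≢x with ∈-++⁻ (topKeys l) y∈
  ... | inj₁ y∈l = ∈-++⁺ˡ y∈l
  ... | inj₂ (here y≡q) = ∈-++⁺ʳ _ (here y≡q)
  ... | inj₂ (there y∈r) = ∈-++⁺ʳ _ (there (keeps y∈r y≢x))

replug-left : ∀ {a b} x (l : Top a) q (r : Top b) (vl : Vec Tree a) (vr : Vec Tree b) →
  x ∉ inorder (plug r vr) →
  Replugged x (size l) (topKeys l) (dropMaxAt vl (hole-of x l)) (del x (plug l vl)) →
  Replugged x (size (node l q r)) (topKeys (node l q r)) (dropMaxAt (vl Vec.++ vr) (hole-of x l ↑ˡ b))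
            (node (del x (plug l vl)) q (del x (plug r vr)))
replug-left x l q r vl vr x∉r L rewrite dropMaxAt-↑ˡ vl vr (hole-of x l) = record
  { top = node top q r
  ; plugged = trans (cong₂ (λ l' r' → node l' q r') plugged (del-∉ (plug r vr) x∉r)) (sym (plug-node top q r _ vr))
  ; smaller = ℕP.+-monoˡ-≤ (suc (size r)) smaller
  ; keeps = keeps' }
  where
  open Replugged L
  keeps' : ∀ {y} → y ∈ topKeys l ++ q ∷ topKeys r → y ≢ x → y ∈ topKeys top ++ q ∷ topKeys r
  keeps' y∈ y≢x with ∈-++⁻ (topKeys l) y∈
  ... | inj₁ y∈l = ∈-++⁺ˡ (keeps y∈l y≢x)
  ... | inj₂ y∈qr = ∈-++⁺ʳ _ y∈qr

del-plug : ∀ {k} x (T : Top k) (v : Vec Tree k) → Sorted (inorder (plug T v)) → x ∈ topKeys T →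
  Replugged x (size T) (topKeys T) (dropMaxAt v (hole-of x T)) (del x (plug T v))
del-plug x hole v s ()
del-plug x (node {a} l q r) v s x∈ with Vec.splitAt a v
... | vl , vr , refl with pivot⁻ {inorder (plug l vl)} s | q ℚ.<? x | q ℚP.≟ x | ∈-++⁻ (topKeys l) x∈
... | _ | yes q<x | yes refl | _ = ⊥-elim (ℚP.<-irrefl refl q<x)
... | _ | _ | no q≢x | inj₂ (here x≡q) = ⊥-elim (q≢x (sym x≡q))
... | around sl sr lt gt | yes q<x | no _ | inj₁ x∈l = ⊥-elim (ℚP.<-asym q<x (lt (touched⊆ l vl x∈l)))
... | around sl sr lt gt | yes q<x | no _ | inj₂ (there x∈r) =
  replug-right x l q r vl vr (λ x∈ → ℚP.<-asym q<x (lt x∈)) (del-plug x r vr sr x∈r)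
... | around sl sr lt gt | no q≮x | yes refl | _ = replug-root x l r vl vr (λ y∈ → lt (touched⊆ l vl y∈))
... | around sl sr lt gt | no q≮x | no _ | inj₂ (there x∈r) = ⊥-elim (q≮x (gt (touched⊆ r vr x∈r)))
... | around sl sr lt gt | no q≮x | no _ | inj₁ x∈l =
  replug-left x l q r vl vr (λ x∈ → q≮x (gt x∈)) (del-plug x l vl sl x∈l)

module _ {K : KeySet} {x : ℚ} (x∉K : ¬ K x) where

  del-step-untouched : ∀ {t y c t'} → IsBST (K ⊕ x) t → (st : Step (K ⊕ x) t y c t') →
    x ∉ topKeys (Step.touched st) → Step K (del x t) y c (del x t')
  del-step-untouched {t' = t'} bst st x∉T = record
    { holes = holes ; touched = touched ; subs = Vec.map (del x) subs ; newTop = newTop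
    ; split = trans (cong (del x) split) (del-plug-untouched x touched subs x∉T)
    ; hasX = hasX
    ; result = trans (cong (del x) result) (del-plug-untouched x newTop subs
        (subst (x ∉_) (step-touched bst st) x∉T))
    ; isBST' = del-bst t' isBST' x∉K
    ; cost = cost }
    where open Step st

  del-step-touched : ∀ {t y c t'} → IsBST (K ⊕ x) t → y ≢ x → (st : Step (K ⊕ x) t y c t') →
    x ∈ topKeys (Step.touched st) → Σ[ c' ∈ ℕ ] c' ≤ c × Step K (del x t) y c' (del x t')
  del-step-touched {c = c} {t' = t'} bst y≢x st x∈T = size (top before) , smaller-cost , record
    { holes = proj₁ subs' ; touched = top before ; subs = proj₂ subs' ; newTop = top after
    ; split = trans (cong (del x) split) (plugged before)
    ; hasX = keeps before hasX y≢x
    ; result = trans (cong (del x) result) (plugged after)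
    ; isBST' = del-bst t' isBST' x∉K
    ; cost = refl }
    where
    open Step st
    open Replugged
    subs' : Subtrees
    subs' = dropMaxAt subs (hole-of x touched)
    before : Replugged x (size touched) (topKeys touched) subs' (del x (plug touched subs))
    before = del-plug x touched subs (linked⇒sorted (proj₁ (proj₁ (step-plugs bst st)))) x∈T
    after : Replugged x (size newTop) (topKeys newTop) subs' (del x (plug newTop subs))
    after = subst (λ i → Replugged x (size newTop) (topKeys newTop) (dropMaxAt subs i) (del x (plug newTop subs)))
      (sym (step-hole-of x bst st))
      (del-plug x newTop subs (linked⇒sorted (proj₁ (proj₂ (step-plugs bst st))))
        (subst (x ∈_) (step-touched bst st) x∈T))
    smaller-cost : size (top before) ≤ c
    smaller-cost = subst (size (top before) ≤_) (sym cost) (smaller before)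

  del-step : ∀ {t y c t'} → IsBST (K ⊕ x) t → y ≢ x → Step (K ⊕ x) t y c t' →
    Σ[ c' ∈ ℕ ] c' ≤ c × Step K (del x t) y c' (del x t')
  del-step {c = c} bst y≢x st with x ∈? topKeys (Step.touched st)
  ... | yes x∈T = del-step-touched bst y≢x st x∈T
  ... | no x∉T = c , ℕP.≤-refl , del-step-untouched bst st x∉T

  del-serves : ∀ {t S c} → IsBST (K ⊕ x) t → All (_≢ x) S → Serves (K ⊕ x) t S c →
    Σ[ c' ∈ ℕ ] c' ≤ c × Serves K (del x t) S c'
  del-serves bst [] done = 0 , z≤n , done
  del-serves bst (y≢x ∷ S≢x) (step st rest)
    with del-step bst y≢x st | del-serves (Step.isBST' st) S≢x rest
  ... | c₁' , c₁'≤ , st' | c₂' , c₂'≤ , rest' = c₁' + c₂' , ℕP.+-mono-≤ c₁'≤ c₂'≤ , step st' rest'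

  achieves-del : ∀ {S c} → All (_≢ x) S → Achieves (K ⊕ x) S c → Σ[ c' ∈ ℕ ] c' ≤ c × Achieves K S c'
  achieves-del S≢x (t₀ , bst , serves) with del-serves bst S≢x serves
  ... | c' , c'≤c , serves' = c' , c'≤c , del x t₀ , del-bst t₀ bst x∉K , serves'

-- Adding or removing finitely many auxiliary keys, one at a time; a key
-- occurring twice in X is handled once.
∪-[] : ∀ K → (K ∪ []) ≐ K
∪-[] K q = mk⇔ (λ { (inj₁ q∈K) → q∈K ; (inj₂ ()) }) inj₁

∪-∷ : ∀ K {x X} → (K ∪ (x ∷ X)) ≐ ((K ∪ X) ⊕ x)
∪-∷ K q = mk⇔
  (λ { (inj₁ q∈K) → inj₁ (inj₁ q∈K) ; (inj₂ (here q≡x)) → inj₂ q≡x ; (inj₂ (there q∈X)) → inj₁ (inj₂ q∈X) })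
  (λ { (inj₁ (inj₁ q∈K)) → inj₁ q∈K ; (inj₁ (inj₂ q∈X)) → inj₂ (there q∈X) ; (inj₂ q≡x) → inj₂ (here q≡x) })

∪-∷-dup : ∀ K {x X} → x ∈ X → (K ∪ (x ∷ X)) ≐ (K ∪ X)
∪-∷-dup K x∈X q = mk⇔
  (λ { (inj₁ q∈K) → inj₁ q∈K ; (inj₂ (here refl)) → inj₂ x∈X ; (inj₂ (there q∈X)) → inj₂ q∈X })
  (λ { (inj₁ q∈K) → inj₁ q∈K ; (inj₂ q∈X) → inj₂ (there q∈X) })

∉-∪ : ∀ K {x X} → ¬ K x → x ∉ X → ¬ (K ∪ X) x
∉-∪ K x∉K x∉X (inj₁ x∈K) = x∉K x∈K
∉-∪ K x∉K x∉X (inj₂ x∈X) = x∉X x∈X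

achieves-extend : ∀ {K} X → All (λ q → ¬ K q) X → ∀ {S c} → Achieves K S c → Achieves (K ∪ X) S c
achieves-extend {K} [] [] achieved = achieves-resp (≐-sym (∪-[] K)) achieved
achieves-extend {K} (x ∷ X) (x∉K ∷ X∉K) achieved with x ∈? X
... | yes x∈X = achieves-resp (≐-sym (∪-∷-dup K x∈X)) (achieves-extend X X∉K achieved)
... | no x∉X =
  achieves-resp (≐-sym (∪-∷ K)) (achieves-ins (∉-∪ K x∉K x∉X) (achieves-extend X X∉K achieved))

never-accessed : ∀ {K : KeySet} {x : ℚ} {S : List ℚ} → ¬ K x → All K S → All (_≢ x) S
never-accessed {K} x∉K = All.map (λ y∈K y≡x → x∉K (subst K y≡x y∈K))

achieves-restrict : ∀ {K} X → All (λ q → ¬ K q) X → ∀ {S} → All K S →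
  ∀ {c} → Achieves (K ∪ X) S c → Σ[ c' ∈ ℕ ] c' ≤ c × Achieves K S c'
achieves-restrict {K} [] [] S⊆K {c} achieved = c , ℕP.≤-refl , achieves-resp (∪-[] K) achieved
achieves-restrict {K} (x ∷ X) (x∉K ∷ X∉K) S⊆K achieved with x ∈? X
... | yes x∈X = achieves-restrict X X∉K S⊆K (achieves-resp (∪-∷-dup K x∈X) achieved)
... | no x∉X with achieves-del (∉-∪ K x∉K x∉X) (never-accessed x∉K S⊆K) (achieves-resp (∪-∷ K) achieved)
...   | c'' , c''≤c , achieved' with achieves-restrict X X∉K S⊆K achieved'
...     | c' , c'≤c'' , achieved'' = c' , ℕP.≤-trans c'≤c'' c''≤c , achieved''

opt-transfer : ∀ {K K' S} → (∀ {c} → Achieves K S c → Achieves K' S c) →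
  (∀ {c} → Achieves K' S c → Σ[ c' ∈ ℕ ] c' ≤ c × Achieves K S c') →
  ∀ k → IsOPT K S k ⇔ IsOPT K' S k
opt-transfer {K} {K'} {S} extend restrict k = mk⇔ to from
  where
  to : IsOPT K S k → IsOPT K' S k
  to (achieved , optimal) = extend achieved , λ c achieved' →
    let (c' , c'≤c , achieved'') = restrict achieved' in ℕP.≤-trans (optimal c' achieved'') c'≤c
  from : IsOPT K' S k → IsOPT K S k
  from (achieved , optimal) with restrict achieved
  ... | c' , c'≤k , achieved' =
    subst (Achieves K S) (ℕP.≤-antisym c'≤k (optimal c' (extend achieved'))) achieved' ,
    λ c achieved'' → optimal c (extend achieved'')

toKeys-∈ : ∀ {n m} (S : Vec (Fin n) m) → All [ n ] (toKeys S)
toKeys-∈ [] = []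
toKeys-∈ (i ∷ S) = (i , refl) ∷ toKeys-∈ S

mainTheorem16 : (n m : ℕ) (S : Vec (Fin n) m) (X : List ℚ) →
    All (λ q → ¬ [ n ] q) X →
    (k : ℕ) → IsOPT [ n ] (toKeys S) k ⇔ IsOPT ([ n ] ∪ X) (toKeys S) k
mainTheorem16 n m S X X∉[n] =
  opt-transfer (achieves-extend X X∉[n]) (achieves-restrict X X∉[n] (toKeys-∈ S))
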